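{- Let $P$ be a program, $M\subseteq\mathrm{at}(P)$, $M_P=M\cup\{\overline{x}\mid x\in\mathrm{at}(P)\setminus M\}$, and $P^\ast=P_{\mathrm{trans}}\cup\{y_x\leftarrow t_x\mid x,y\in\mathrm{at}(P)\}$. Then $M$ is an answer set of $P$ if and only if $M'=M_P\cup\bigcup_{x\in M}(\mathrm{at}(P)\cup\{t\})_x$ is an answer set of $P^\ast$. Moreover, every answer set of $P^\ast$ is of the form $M'$ for some $M\subseteq\mathrm{at}(P)$.
   Context: A rule $r$ is an expression $a_1\vee\cdots\vee a_l\leftarrow a_{l+1},\ldots,a_m,\mathit{not}\ a_{m+1},\ldots,\mathit{not}\ a_n$ with propositional atoms; $H(r)$ head atoms, $B^+(r)$, $B^-(r)$ positive/negative body atoms; $\bot$ denotes an empty head. A program is a finite set of rules; $\mathrm{at}(P)$ its atoms; $P_r=\{r\in P\mid H(r)\ne\emptyset\}$. A set $I$ of atoms satisfies $r$ if $(H(r)\cup B^-(r))\cap I\neq\emptyset$ or $B^+(r)\setminus I\neq\emptyset$; a model satisfies all rules. Reduct: $P^I=\{H(r)\leftarrow B^+(r)\mid r\in P, I\cap B^-(r)=\emptyset\}$. $I$ is an answer set of $P$ if it is an inclusion-minimal model of $P^I$. Let $t$ be a fresh atom, $P_r[t]=\{H(r)\leftarrow t,\mathit{not}\ B^-(r)\mid r\in P_r,B^+(r)=\emptyset\}\cup\{r\in P_r\mid B^+(r)\ne\emptyset\}$. For $x\in\mathrm{at}(P)$, $y\in\mathrm{at}(P)\cup\{t\}$, $y_x$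 is a fresh atom (all distinct); $Y_x=\{y_x\mid y\in Y\}$. $P_x=\{B^+_x\leftarrow H_x,\mathit{not}\ B^-\mid (H\leftarrow B^+,\mathit{not}\ B^-)\in P_r[t]\}$. For each $x\in\mathrm{at}(P)$, $\overline{x}$ is a further fresh atom. Define $P_{\mathrm{xor}}=\{x\leftarrow\mathit{not}\ \overline{x};\ \overline{x}\leftarrow\mathit{not}\ x\mid x\in\mathrm{at}(P)\}$, $P_{\mathrm{aux}}=\{x_x\leftarrow\mathit{not}\ \overline{x};\ y_x\leftarrow\mathit{not}\ \overline{x},\mathit{not}\ y\mid x,y\in\mathrm{at}(P)\}$, $P_{\mathrm{diag}}=P_{\mathrm{xor}}\cup P_{\mathrm{aux}}\cup\bigcup_{x\in\mathrm{at}(P)}P_x$, $P_{\mathrm{mod}}=\{\bot\leftarrow B^+,\mathit{not}\ (H\cup B^-)\mid (H\leftarrow B^+,\mathit{not}\ B^-)\in P\}$, $P_{\mathrm{true}}=\{\bot\leftarrow x,\mathit{not}\ t_x\mid x\in\mathrm{at}(P)\}$, $P_{\mathrm{trans}}=P_{\mathrm{diag}}\cup P_{\mathrm{mod}}\cup P_{\mathrm{true}}$. -}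

module Defs where

open import Data.Nat using (ℕ; _≟_)
open import Data.Bool using (Bool; true; false; _∧_; _∨_; not)
open import Data.Maybe using (Maybe; just; nothing)
open import Data.List using (List; []; _∷_; _++_; map; concatMap; filterᵇ; null)
open import Data.Bool.ListAction using (any; all)
open import Data.List.Relation.Unary.All using (All)
open import Data.Product using (_×_)
open import Relation.Binary.PropositionalEquality using (_≡_)
open import Relation.Nullary.Decidable using (⌊_⌋)

infix 4 _⇐_∣_

record Rule (A : Set) : Set where
  constructor _⇐_∣_
  field
    head : List A   -- H(r)   (empty list = ⊥)
    pos  : List A
    neg  : List A
open Rule public

Program : Set → Set
Program A = List (Rule A)

Interp : Set → Set
Interp A = A → Bool

_⊆_ : {A : Set} → Interp A → Interp A → Set
J ⊆ I = ∀ a → J a ≡ true → I a ≡ true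

sat : {A : Set} → Interp A → Rule A → Bool
sat I r = any I (head r ++ neg r) ∨ not (all I (pos r))

IsModel : {A : Set} → Program A → Interp A → Set
IsModel P I = All (λ r → sat I r ≡ true) P

reduct : {A : Set} → Program A → Interp A → Program A
reduct P I = map (λ r → head r ⇐ pos r ∣ []) (filterᵇ (λ r → not (any I (neg r))) P)

AnswerSet : {A : Set} → Program A → Interp A → Set
AnswerSet {A} P I =
  IsModel (reduct P I) I ×
  (∀ (J : Interp A) → IsModel (reduct P I) J → J ⊆ I → I ⊆ J)

-- at(P), as a list (possibly with repetitions)
atoms : Program ℕ → List ℕ
atoms P = concatMap (λ r → head r ++ pos r ++ neg r) P

_∈ᵇ_ : ℕ → List ℕ → Bool
x ∈ᵇ xs = any (λ y → ⌊ x ≟ y ⌋) xs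

Pr : {A : Set} → Program A → Program A
Pr P = filterᵇ (λ r → not (null (head r))) P

-- P_r[t]; atom `nothing` is the fresh atom t
liftRule : {A : Set} → Rule A → Rule (Maybe A)
liftRule r = map just (head r) ⇐ map just (pos r) ∣ map just (neg r)

Prt : {A : Set} → Program A → Program (Maybe A)
Prt P = map tr (Pr P)
  where
  tr : _ → _
  tr r with null (pos r)
  ... | true  = map just (head r) ⇐ (nothing ∷ []) ∣ map just (neg r)
  ... | false = liftRule r

data TAtom : Set where
  atm : Maybe ℕ → TAtom          -- original atoms x (and t = atm nothing)
  bar : ℕ → TAtom
  sub : Maybe ℕ → ℕ → TAtom      -- y_x  (y ∈ at(P) ∪ {t}; sub nothing x = t_x)

orig : ℕ → TAtom
orig x = atm (just x)

Px : Program ℕ → ℕ → Program TAtom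
Px P x = map (λ r → map (λ y → sub y x) (pos r) ⇐ map (λ h → sub h x) (head r) ∣ map atm (neg r)) (Prt P)

Pxor : Program ℕ → Program TAtom
Pxor P = concatMap (λ x → (orig x ∷ [] ⇐ [] ∣ bar x ∷ [])
                        ∷ (bar x ∷ [] ⇐ [] ∣ orig x ∷ []) ∷ []) (atoms P)

Paux : Program ℕ → Program TAtom
Paux P = concatMap (λ x → (sub (just x) x ∷ [] ⇐ [] ∣ bar x ∷ [])
          ∷ map (λ y → sub (just y) x ∷ [] ⇐ [] ∣ bar x ∷ orig y ∷ []) (atoms P)) (atoms P)

Pdiag : Program ℕ → Program TAtom
Pdiag P = Pxor P ++ Paux P ++ concatMap (Px P) (atoms P)

Pmod : Program ℕ → Program TAtom
Pmod P = map (λ r → [] ⇐ map orig (pos r) ∣ map orig (head r ++ neg r)) P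

Ptrue : Program ℕ → Program TAtom
Ptrue P = map (λ x → [] ⇐ orig x ∷ [] ∣ sub nothing x ∷ []) (atoms P)

Ptrans : Program ℕ → Program TAtom
Ptrans P = Pdiag P ++ Pmod P ++ Ptrue P

Pstar : Program ℕ → Program TAtom
Pstar P = Ptrans P ++
  concatMap (λ x → map (λ y → sub (just y) x ∷ [] ⇐ sub nothing x ∷ [] ∣ []) (atoms P)) (atoms P)

M′ : Program ℕ → Interp ℕ → Interp TAtom
M′ P M (atm nothing)  = false
M′ P M (atm (just x)) = M x
M′ P M (bar x)        = (x ∈ᵇ atoms P) ∧ not (M x)
M′ P M (sub nothing x)  = M x
M′ P M (sub (just y) x) = M x ∧ (y ∈ᵇ atoms P)

module Submission where

-- All minimality arguments are instances of a single
-- principle (answerSet-disjoint): if I ∖ D still satisfies P^I, then I ∩ D = ∅.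
--
-- For minimality, a
--    model J ⊆ M′ of P*^{M′} contains x, x̄, and all y_x once t_x ∈ J; and t_x ∈ J
--    for x ∈ M, since otherwise M minus {y | y_x ∈ J} would be a smaller model of P^M
--    (the rules of P_x transport P^M backwards), while x_x ∈ J.
--  * Backward: the constraints P_mod give M ⊨ P^M; a model J ⊊ M of P^M missing x
--    lets us remove t_x and {y_x | y ∈ J} from M′, contradicting minimality of M′.
--  * Shape:    in an answer set I of P* nothing outside at(P) holds, exactly one of
--    x, x̄ holds, and all copies y_x hold iff x does, so I = M′ for M = I ∩ at(P).

open import Defs
open import Data.Nat using (ℕ; _≟_)
open import Data.Bool using (Bool; true; false; _∧_; not)
open import Data.Bool.Properties using (∧-zeroʳ; ∧-identityʳ; ∧-conicalˡ; ∧-conicalʳ; T-≡; ¬-not; not-injective)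
open import Data.Maybe using (Maybe; just; nothing)
open import Data.List using (List; []; _∷_; _++_; map; concatMap; null)
open import Data.List.Properties using (++-identityʳ)
open import Data.Bool.ListAction using (any; all)
open import Data.List.Relation.Unary.All using ([]; _∷_)
open import Data.List.Relation.Unary.Any using (here; there)
open import Data.List.Relation.Unary.Any.Properties using (any⁺; any⁻)
open import Data.List.Membership.Propositional using (_∈_; find; lose)
open import Data.List.Membership.DecPropositional _≟_ using (_∈?_)
open import Data.List.Membership.Propositional.Properties using (∈-map⁺; ∈-map⁻; ∈-++⁺ˡ; ∈-++⁺ʳ; ∈-++⁻; ∈-concatMap⁺; ∈-concatMap⁻)
open import Data.Product using (_×_; Σ; _,_; proj₁; ∃)
open import Data.Sum using (_⊎_; inj₁; inj₂)
open import Data.Empty using (⊥; ⊥-elim)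
open import Function.Bundles using (_⇔_; mk⇔; Equivalence)
open import Relation.Binary.PropositionalEquality using (_≡_; _≢_; refl; sym; trans; cong; cong₂; subst; module ≡-Reasoning)
open import Relation.Nullary using (¬_)
open import Relation.Nullary.Decidable using (⌊_⌋; yes; no)

clash : {X : Set} {b : Bool} → b ≡ true → b ≡ false → X
clash refl ()

module _ {A : Set} where

  any-true⁻ : (f : A → Bool) (xs : List A) → any f xs ≡ true → ∃ λ a → a ∈ xs × f a ≡ true
  any-true⁻ f xs e with a , a∈xs , fa ← find (any⁻ f xs (Equivalence.from T-≡ e))
    = a , a∈xs , Equivalence.to T-≡ fa

  any-true⁺ : (f : A → Bool) (xs : List A) {a : A} → a ∈ xs → f a ≡ true → any f xs ≡ true
  any-true⁺ f xs a∈xs fa = Equivalence.to T-≡ (any⁺ f (lose a∈xs (Equivalence.from T-≡ fa)))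

  any-false⁻ : (f : A → Bool) (xs : List A) → any f xs ≡ false → ∀ a → a ∈ xs → f a ≡ false
  any-false⁻ f xs e a a∈xs = ¬-not λ fa → clash (any-true⁺ f xs a∈xs fa) e

  all-false⁻ : (f : A → Bool) (xs : List A) → all f xs ≡ false → ∃ λ a → a ∈ xs × f a ≡ false
  all-false⁻ f (x ∷ xs) e with f x in fx
  ... | false = x , here refl , fx
  ... | true with a , a∈xs , fa ← all-false⁻ f xs e = a , there a∈xs , fa

  all-false⁺ : (f : A → Bool) (xs : List A) {a : A} → a ∈ xs → f a ≡ false → all f xs ≡ false
  all-false⁺ f (x ∷ xs) (here refl) fa rewrite fa = refl
  all-false⁺ f (x ∷ xs) (there a∈xs) fa with f x
  ... | false = refl
  ... | true = all-false⁺ f xs a∈xs fa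

  SatPos : Interp A → List A → List A → Set
  SatPos J h p = (∃ λ a → a ∈ h × J a ≡ true) ⊎ (∃ λ a → a ∈ p × J a ≡ false)

  Applies : Interp A → Rule A → Set
  Applies I r = ∀ a → a ∈ neg r → I a ≡ false

  SatRed : Interp A → Interp A → Rule A → Set
  SatRed I J r = Applies I r → SatPos J (head r) (pos r)

  sat-positive⁻ : (J : Interp A) (h p : List A) → sat J (h ⇐ p ∣ []) ≡ true → SatPos J h p
  sat-positive⁻ J h p e with any J (h ++ []) in e₁
  ... | true with a , a∈h , Ja ← any-true⁻ J (h ++ []) e₁
    = inj₁ (a , subst (a ∈_) (++-identityʳ h) a∈h , Ja)
  sat-positive⁻ J h p e | false with all J p in e₂
  sat-positive⁻ J h p () | false | true
  ... | false = inj₂ (all-false⁻ J p e₂)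

  sat-positive⁺ : (J : Interp A) (h p : List A) → SatPos J h p → sat J (h ⇐ p ∣ []) ≡ true
  sat-positive⁺ J h p (inj₁ (a , a∈h , Ja))
    rewrite any-true⁺ J (h ++ []) (∈-++⁺ˡ a∈h) Ja = refl
  sat-positive⁺ J h p (inj₂ (a , a∈p , Ja))
    rewrite all-false⁺ J p a∈p Ja with any J (h ++ [])
  ... | true = refl
  ... | false = refl

  reduct-model⁻ : (P : Program A) (I J : Interp A) →
    IsModel (reduct P I) J → ∀ r → r ∈ P → SatRed I J r
  reduct-model⁻ (r ∷ P) I J mJ .r (here refl) applies with any I (neg r) in e
  ... | true with a , a∈neg , Ia ← any-true⁻ I (neg r) e = clash Ia (applies a a∈neg)
  reduct-model⁻ (r ∷ P) I J (sr ∷ _) .r (here refl) applies | false = sat-positive⁻ J (head r) (pos r) sr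
  reduct-model⁻ (r ∷ P) I J mJ r′ (there r′∈P) with any I (neg r)
  ... | true = reduct-model⁻ P I J mJ r′ r′∈P
  reduct-model⁻ (r ∷ P) I J (_ ∷ mJ) r′ (there r′∈P) | false = reduct-model⁻ P I J mJ r′ r′∈P

  reduct-model⁺ : (P : Program A) (I J : Interp A) →
    (∀ r → r ∈ P → SatRed I J r) → IsModel (reduct P I) J
  reduct-model⁺ [] I J h = []
  reduct-model⁺ (r ∷ P) I J h with any I (neg r) in e
  ... | true = reduct-model⁺ P I J (λ r′ r′∈P → h r′ (there r′∈P))
  ... | false = sat-positive⁺ J (head r) (pos r) (h r (here refl) (any-false⁻ I (neg r) e))
              ∷ reduct-model⁺ P I J (λ r′ r′∈P → h r′ (there r′∈P))

  _∖_ : Interp A → (A → Bool) → Interp A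
  (I ∖ D) a = not (D a) ∧ I a

  ∖-⊆ : (I : Interp A) (D : A → Bool) → (I ∖ D) ⊆ I
  ∖-⊆ I D a e = ∧-conicalʳ (not (D a)) (I a) e

  ∖-removed : (I : Interp A) (D : A → Bool) (a : A) → D a ≡ true → (I ∖ D) a ≡ false
  ∖-removed I D a Da rewrite Da = refl

  ∖-kept : (I : Interp A) (D : A → Bool) (a : A) → D a ≡ false → (I ∖ D) a ≡ I a
  ∖-kept I D a Da rewrite Da = refl

  answerSet-disjoint : (P : Program A) (I : Interp A) (D : A → Bool) → AnswerSet P I →
    (∀ r → r ∈ P → SatRed I (I ∖ D) r) → ∀ a → D a ≡ true → I a ≡ false
  answerSet-disjoint P I D (_ , minimal) sr a Da with I a in Ia
  ... | false = refl
  ... | true = clash (minimal (I ∖ D) (reduct-model⁺ P I (I ∖ D) sr) (∖-⊆ I D) a Ia) (∖-removed I D a Da)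

  ∖-satRed : (I : Interp A) (D : A → Bool) (r : Rule A) → SatRed I I r →
    (Applies I r → ∀ a → a ∈ head r → I a ≡ true → D a ≡ false) → SatRed I (I ∖ D) r
  ∖-satRed I D r sr spared applies with sr applies
  ... | inj₁ (a , a∈h , Ia) = inj₁ (a , a∈h , trans (∖-kept I D a (spared applies a a∈h Ia)) Ia)
  ... | inj₂ (a , a∈p , Ia) = inj₂ (a , a∈p , trans (cong (not (D a) ∧_) Ia) (∧-zeroʳ (not (D a))))

  forced : (I J : Interp A) {a : A} {n : List A} →
    SatRed I J (a ∷ [] ⇐ [] ∣ n) → Applies I (a ∷ [] ⇐ [] ∣ n) → J a ≡ true
  forced I J sr applies with sr applies
  ... | inj₁ (_ , here refl , Ja) = Ja

  forced-by : (I J : Interp A) {a b : A} →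
    SatRed I J (a ∷ [] ⇐ b ∷ [] ∣ []) → J b ≡ true → J a ≡ true
  forced-by I J sr Jb with sr (λ _ ())
  ... | inj₁ (_ , here refl , Ja) = Ja
  ... | inj₂ (_ , here refl , Jb′) = clash Jb Jb′

  excluded : (I J : Interp A) {b : A} {n : List A} →
    SatRed I J ([] ⇐ b ∷ [] ∣ n) → Applies I ([] ⇐ b ∷ [] ∣ n) → J b ≡ false
  excluded I J sr applies with sr applies
  ... | inj₂ (_ , here refl , Jb) = Jb

null-empty : {A : Set} (xs : List A) {a : A} → null xs ≡ true → ¬ a ∈ xs
null-empty (x ∷ xs) () a∈

null-nonempty : {A : Set} (xs : List A) → null xs ≡ false → ∃ λ a → a ∈ xs
null-nonempty (x ∷ xs) _ = x , here refl

concatMap⁻ : {A B : Set} (f : A → List B) (xs : List A) {b : B} →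
  b ∈ concatMap f xs → ∃ λ a → a ∈ xs × b ∈ f a
concatMap⁻ f xs b∈ = find (∈-concatMap⁻ f b∈)

concatMap⁺ : {A B : Set} (f : A → List B) {xs : List A} {a : A} {b : B} →
  a ∈ xs → b ∈ f a → b ∈ concatMap f xs
concatMap⁺ f a∈ b∈ = ∈-concatMap⁺ f (lose a∈ b∈)

same : ℕ → ℕ → Bool
same x y = ⌊ x ≟ y ⌋

same-refl : ∀ x → same x x ≡ true
same-refl x with x ≟ x
... | yes _ = refl
... | no x≢x = ⊥-elim (x≢x refl)

same⇒≡ : ∀ {x y} → same x y ≡ true → x ≡ y
same⇒≡ {x} {y} e with x ≟ y
... | yes x≡y = x≡y

same-≢ : ∀ {x y} → x ≢ y → same x y ≡ false
same-≢ x≢y = ¬-not λ e → x≢y (same⇒≡ e)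

∈ᵇ⁺ : ∀ {x xs} → x ∈ xs → x ∈ᵇ xs ≡ true
∈ᵇ⁺ {x} {xs} x∈xs = any-true⁺ (same x) xs x∈xs (same-refl x)

∈ᵇ⁻ : ∀ {x xs} → x ∈ᵇ xs ≡ true → x ∈ xs
∈ᵇ⁻ {x} {xs} e with y , y∈xs , same-xy ← any-true⁻ (same x) xs e with refl ← same⇒≡ same-xy = y∈xs

∉ᵇ : ∀ {x xs} → ¬ x ∈ xs → x ∈ᵇ xs ≡ false
∉ᵇ x∉xs = ¬-not λ e → x∉xs (∈ᵇ⁻ e)

atoms-head : (P : Program ℕ) {r : Rule ℕ} {a : ℕ} → r ∈ P → a ∈ head r → a ∈ atoms P
atoms-head P r∈P a∈h = concatMap⁺ _ r∈P (∈-++⁺ˡ a∈h)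

atoms-pos : (P : Program ℕ) {r : Rule ℕ} {a : ℕ} → r ∈ P → a ∈ pos r → a ∈ atoms P
atoms-pos P {r} r∈P a∈p = concatMap⁺ _ r∈P (∈-++⁺ʳ (head r) (∈-++⁺ˡ a∈p))

tBody : Rule ℕ → List (Maybe ℕ)
tBody (h ⇐ [] ∣ n) = nothing ∷ []
tBody (h ⇐ (p ∷ ps) ∣ n) = map just (p ∷ ps)

tRule : Rule ℕ → Rule (Maybe ℕ)
tRule r = map just (head r) ⇐ tBody r ∣ map just (neg r)

diagRule : ℕ → Rule ℕ → Rule TAtom
diagRule x r = map (λ y → sub y x) (pos (tRule r)) ⇐ map (λ h → sub h x) (head (tRule r))
             ∣ map atm (neg (tRule r))

Prt⁻ : (P : Program ℕ) {r′ : Rule (Maybe ℕ)} → r′ ∈ Prt P →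
  ∃ λ r → r ∈ P × null (head r) ≡ false × r′ ≡ tRule r
Prt⁻ (([] ⇐ p ∣ n) ∷ P) r′∈ with r , r∈P , hr , refl ← Prt⁻ P r′∈ = r , there r∈P , hr , refl
Prt⁻ ((h ∷ hs ⇐ [] ∣ n) ∷ P) (here refl) = _ , here refl , refl , refl
Prt⁻ ((h ∷ hs ⇐ (p ∷ ps) ∣ n) ∷ P) (here refl) = _ , here refl , refl , refl
Prt⁻ ((h ∷ hs ⇐ p ∣ n) ∷ P) (there r′∈) with r , r∈P , hr , refl ← Prt⁻ P r′∈
  = r , there r∈P , hr , refl

Prt⁺ : (P : Program ℕ) {r : Rule ℕ} → r ∈ P → null (head r) ≡ false → tRule r ∈ Prt P
Prt⁺ ((h ∷ hs ⇐ [] ∣ n) ∷ P) (here refl) hr = here refl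
Prt⁺ ((h ∷ hs ⇐ (p ∷ ps) ∣ n) ∷ P) (here refl) hr = here refl
Prt⁺ (([] ⇐ p ∣ n) ∷ P) (here refl) ()
Prt⁺ (([] ⇐ p ∣ n) ∷ P) (there r∈P) hr = Prt⁺ P r∈P hr
Prt⁺ ((h ∷ hs ⇐ p ∣ n) ∷ P) (there r∈P) hr = there (Prt⁺ P r∈P hr)

module _ (x : ℕ) where

  diag-head⁻ : (r : Rule ℕ) {a : TAtom} → a ∈ head (diagRule x r) →
    a ≡ sub nothing x ⊎ ∃ λ p → p ∈ pos r × a ≡ sub (just p) x
  diag-head⁻ (h ⇐ [] ∣ n) (here refl) = inj₁ refl
  diag-head⁻ (h ⇐ (p ∷ ps) ∣ n) a∈ with _ , q∈ , refl ← ∈-map⁻ _ a∈ with q , q∈p , refl ← ∈-map⁻ _ q∈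
    = inj₂ (q , q∈p , refl)

  diag-head⁺ : (r : Rule ℕ) {p : ℕ} → p ∈ pos r → sub (just p) x ∈ head (diagRule x r)
  diag-head⁺ (h ⇐ (q ∷ ps) ∣ n) p∈ = ∈-map⁺ _ (∈-map⁺ _ p∈)

  diag-head-witness : (r : Rule ℕ) → ∃ λ a → a ∈ head (diagRule x r) ×
    (a ≡ sub nothing x ⊎ ∃ λ p → p ∈ pos r × a ≡ sub (just p) x)
  diag-head-witness (h ⇐ [] ∣ n) = _ , here refl , inj₁ refl
  diag-head-witness (h ⇐ (p ∷ ps) ∣ n) = _ , here refl , inj₂ (p , here refl , refl)

  diag-pos⁻ : (r : Rule ℕ) {a : TAtom} → a ∈ pos (diagRule x r) →
    ∃ λ h → h ∈ head r × a ≡ sub (just h) x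
  diag-pos⁻ r a∈ with _ , h∈ , refl ← ∈-map⁻ _ a∈ with h , h∈h , refl ← ∈-map⁻ _ h∈ = h , h∈h , refl

  diag-pos⁺ : (r : Rule ℕ) {h : ℕ} → h ∈ head r → sub (just h) x ∈ pos (diagRule x r)
  diag-pos⁺ r h∈ = ∈-map⁺ _ (∈-map⁺ _ h∈)

  diag-neg⁻ : (r : Rule ℕ) {a : TAtom} → a ∈ neg (diagRule x r) → ∃ λ n → n ∈ neg r × a ≡ orig n
  diag-neg⁻ r a∈ with _ , n∈ , refl ← ∈-map⁻ _ a∈ with n , n∈n , refl ← ∈-map⁻ _ n∈ = n , n∈n , refl

  diag-neg⁺ : (r : Rule ℕ) {n : ℕ} → n ∈ neg r → orig n ∈ neg (diagRule x r)
  diag-neg⁺ r n∈ = ∈-map⁺ _ (∈-map⁺ _ n∈)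

data RuleOf (P : Program ℕ) : Rule TAtom → Set where
  xor-atom  : ∀ x → x ∈ atoms P → RuleOf P (orig x ∷ [] ⇐ [] ∣ bar x ∷ [])
  xor-bar   : ∀ x → x ∈ atoms P → RuleOf P (bar x ∷ [] ⇐ [] ∣ orig x ∷ [])
  aux-self  : ∀ x → x ∈ atoms P → RuleOf P (sub (just x) x ∷ [] ⇐ [] ∣ bar x ∷ [])
  aux-copy  : ∀ x y → x ∈ atoms P → y ∈ atoms P →
              RuleOf P (sub (just y) x ∷ [] ⇐ [] ∣ bar x ∷ orig y ∷ [])
  diag      : ∀ x r → x ∈ atoms P → r ∈ P → null (head r) ≡ false → RuleOf P (diagRule x r)
  mod       : ∀ r → r ∈ P → RuleOf P ([] ⇐ map orig (pos r) ∣ map orig (head r ++ neg r))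
  true-copy : ∀ x → x ∈ atoms P → RuleOf P ([] ⇐ orig x ∷ [] ∣ sub nothing x ∷ [])
  saturate  : ∀ x y → x ∈ atoms P → y ∈ atoms P → RuleOf P (sub (just y) x ∷ [] ⇐ sub nothing x ∷ [] ∣ [])

module _ (P : Program ℕ) where

  classify : (r : Rule TAtom) → r ∈ Pstar P → RuleOf P r
  classify r r∈ with ∈-++⁻ (Ptrans P) r∈
  classify r r∈ | inj₂ r∈sat with concatMap⁻ _ (atoms P) r∈sat
  ... | x , x∈A , r∈x with ∈-map⁻ _ r∈x
  ... | y , y∈A , refl = saturate x y x∈A y∈A
  classify r r∈ | inj₁ r∈trans with ∈-++⁻ (Pdiag P) r∈trans
  classify r r∈ | inj₁ _ | inj₂ r∈mt with ∈-++⁻ (Pmod P) r∈mt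
  ... | inj₁ r∈mod with ∈-map⁻ _ r∈mod
  ... | r₀ , r₀∈P , refl = mod r₀ r₀∈P
  classify r r∈ | inj₁ _ | inj₂ _ | inj₂ r∈true with ∈-map⁻ _ r∈true
  ... | x , x∈A , refl = true-copy x x∈A
  classify r r∈ | inj₁ _ | inj₁ r∈diag with ∈-++⁻ (Pxor P) r∈diag
  ... | inj₁ r∈xor with concatMap⁻ _ (atoms P) r∈xor
  ... | x , x∈A , here refl = xor-atom x x∈A
  ... | x , x∈A , there (here refl) = xor-bar x x∈A
  classify r r∈ | inj₁ _ | inj₁ _ | inj₂ r∈ad with ∈-++⁻ (Paux P) r∈ad
  ... | inj₁ r∈aux with concatMap⁻ _ (atoms P) r∈aux
  ... | x , x∈A , here refl = aux-self x x∈A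
  ... | x , x∈A , there r∈x with ∈-map⁻ _ r∈x
  ... | y , y∈A , refl = aux-copy x y x∈A y∈A
  classify r r∈ | inj₁ _ | inj₁ _ | inj₂ _ | inj₂ r∈px with concatMap⁻ (Px P) (atoms P) r∈px
  ... | x , x∈A , r∈x with ∈-map⁻ _ r∈x
  ... | r′ , r′∈ , refl with Prt⁻ P r′∈
  ... | r₀ , r₀∈P , hr , refl = diag x r₀ x∈A r₀∈P hr

  catalogued : (r : Rule TAtom) → RuleOf P r → r ∈ Pstar P
  catalogued _ (saturate x y x∈A y∈A) = ∈-++⁺ʳ (Ptrans P) (concatMap⁺ _ x∈A (∈-map⁺ _ y∈A))
  catalogued _ (mod r r∈P) = ∈-++⁺ˡ (∈-++⁺ʳ (Pdiag P) (∈-++⁺ˡ (∈-map⁺ _ r∈P)))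
  catalogued _ (true-copy x x∈A) = ∈-++⁺ˡ (∈-++⁺ʳ (Pdiag P) (∈-++⁺ʳ (Pmod P) (∈-map⁺ _ x∈A)))
  catalogued _ (xor-atom x x∈A) = ∈-++⁺ˡ (∈-++⁺ˡ (∈-++⁺ˡ (concatMap⁺ _ x∈A (here refl))))
  catalogued _ (xor-bar x x∈A) = ∈-++⁺ˡ (∈-++⁺ˡ (∈-++⁺ˡ (concatMap⁺ _ x∈A (there (here refl)))))
  catalogued _ (aux-self x x∈A) =
    ∈-++⁺ˡ (∈-++⁺ˡ (∈-++⁺ʳ (Pxor P) (∈-++⁺ˡ (concatMap⁺ _ x∈A (here refl)))))
  catalogued _ (aux-copy x y x∈A y∈A) =
    ∈-++⁺ˡ (∈-++⁺ˡ (∈-++⁺ʳ (Pxor P) (∈-++⁺ˡ (concatMap⁺ _ x∈A (there (∈-map⁺ _ y∈A))))))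
  catalogued _ (diag x r x∈A r∈P hr) =
    ∈-++⁺ˡ (∈-++⁺ˡ (∈-++⁺ʳ (Pxor P) (∈-++⁺ʳ (Paux P) (concatMap⁺ (Px P) x∈A (∈-map⁺ _ (Prt⁺ P r∈P hr))))))

  star-model⁻ : (I J : Interp TAtom) → IsModel (reduct (Pstar P) I) J → ∀ r → RuleOf P r → SatRed I J r
  star-model⁻ I J mJ r k = reduct-model⁻ (Pstar P) I J mJ r (catalogued r k)

  star-model⁺ : (I J : Interp TAtom) → (∀ r → RuleOf P r → SatRed I J r) → IsModel (reduct (Pstar P) I) J
  star-model⁺ I J sr = reduct-model⁺ (Pstar P) I J (λ r r∈ → sr r (classify r r∈))

module _ (P : Program ℕ) (M : Interp ℕ) where

  M′-bar : ∀ {x} → x ∈ atoms P → M′ P M (bar x) ≡ not (M x)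
  M′-bar x∈A rewrite ∈ᵇ⁺ x∈A = refl

  M′-copy : ∀ {x y} → y ∈ atoms P → M′ P M (sub (just y) x) ≡ M x
  M′-copy {x} y∈A rewrite ∈ᵇ⁺ y∈A = ∧-identityʳ (M x)

module Forward (P : Program ℕ) (M : Interp ℕ) (M⊆A : ∀ x → M x ≡ true → x ∈ atoms P) where

  M⋆ : Interp TAtom
  M⋆ = M′ P M

  bar-off : ∀ {x} → x ∈ atoms P → M x ≡ true → M⋆ (bar x) ≡ false
  bar-off x∈A Mx = trans (M′-bar P M x∈A) (cong not Mx)

  bar-off⁻ : ∀ {x} → x ∈ atoms P → M⋆ (bar x) ≡ false → M x ≡ true
  bar-off⁻ x∈A e = not-injective (trans (sym (M′-bar P M x∈A)) e)

  M⋆-model : (∀ r → r ∈ P → SatRed M M r) → ∀ r → RuleOf P r → SatRed M⋆ M⋆ r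
  M⋆-model okP _ (xor-atom x x∈A) applies with M x in Mx
  ... | true = inj₁ (orig x , here refl , Mx)
  ... | false = clash (bar-off⁻ x∈A (applies _ (here refl))) Mx
  M⋆-model okP _ (xor-bar x x∈A) applies =
    inj₁ (bar x , here refl , trans (M′-bar P M x∈A) (cong not (applies _ (here refl))))
  M⋆-model okP _ (aux-self x x∈A) applies =
    inj₁ (_ , here refl , trans (M′-copy P M x∈A) (bar-off⁻ x∈A (applies _ (here refl))))
  M⋆-model okP _ (aux-copy x y x∈A y∈A) applies =
    inj₁ (_ , here refl , trans (M′-copy P M y∈A) (bar-off⁻ x∈A (applies _ (here refl))))
  M⋆-model okP _ (diag x r x∈A r∈P hr) applies with M x in Mx
  ... | true with diag-head-witness x r
  ...   | a , a∈h , inj₁ refl = inj₁ (a , a∈h , Mx)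
  ...   | a , a∈h , inj₂ (p , p∈ , refl) = inj₁ (a , a∈h , trans (M′-copy P M (atoms-pos P r∈P p∈)) Mx)
  M⋆-model okP _ (diag x r x∈A r∈P hr) applies | false with null-nonempty (head r) hr
  ... | h , h∈ = inj₂ (_ , diag-pos⁺ x r h∈ , trans (M′-copy P M (atoms-head P r∈P h∈)) Mx)
  M⋆-model okP _ (mod r r∈P) applies
    with okP r r∈P (λ a a∈ → applies (orig a) (∈-map⁺ orig (∈-++⁺ʳ (head r) a∈)))
  ... | inj₁ (h , h∈ , Mh) = clash Mh (applies (orig h) (∈-map⁺ orig (∈-++⁺ˡ h∈)))
  ... | inj₂ (p , p∈ , Mp) = inj₂ (orig p , ∈-map⁺ orig p∈ , Mp)
  M⋆-model okP _ (true-copy x x∈A) applies = inj₂ (orig x , here refl , applies _ (here refl))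
  M⋆-model okP _ (saturate x y x∈A y∈A) applies with M x in Mx
  ... | true = inj₁ (_ , here refl , trans (M′-copy P M y∈A) Mx)
  ... | false = inj₂ (_ , here refl , Mx)

  module Minimality (asP : AnswerSet P M) (J : Interp TAtom)
                    (mJ : IsModel (reduct (Pstar P) M⋆) J) where

    satJ : ∀ r → RuleOf P r → SatRed M⋆ J r
    satJ = star-model⁻ P M⋆ J mJ

    J-atom : ∀ {x} → x ∈ atoms P → M x ≡ true → J (orig x) ≡ true
    J-atom {x} x∈A Mx = forced M⋆ J (satJ _ (xor-atom x x∈A)) λ { _ (here refl) → bar-off x∈A Mx }

    J-bar : ∀ {x} → x ∈ atoms P → M x ≡ false → J (bar x) ≡ true
    J-bar {x} x∈A Mx = forced M⋆ J (satJ _ (xor-bar x x∈A)) λ { _ (here refl) → Mx }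

    J-self : ∀ {x} → x ∈ atoms P → M x ≡ true → J (sub (just x) x) ≡ true
    J-self {x} x∈A Mx = forced M⋆ J (satJ _ (aux-self x x∈A)) λ { _ (here refl) → bar-off x∈A Mx }

    J-copy : ∀ {x y} → x ∈ atoms P → y ∈ atoms P → M x ≡ true → M y ≡ false → J (sub (just y) x) ≡ true
    J-copy {x} {y} x∈A y∈A Mx My = forced M⋆ J (satJ _ (aux-copy x y x∈A y∈A))
      λ { _ (here refl) → bar-off x∈A Mx ; _ (there (here refl)) → My }

    J-saturated : ∀ {x y} → x ∈ atoms P → y ∈ atoms P → J (sub nothing x) ≡ true → J (sub (just y) x) ≡ true
    J-saturated {x} {y} x∈A y∈A = forced-by M⋆ J (satJ _ (saturate x y x∈A y∈A))

    copied : ℕ → ℕ → Bool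
    copied x y = J (sub (just y) x)

    -- If t_x ∉ J for some x ∈ M, then M minus the atoms copied at x is a model of P^M:
    -- the rules of P_x, read backwards, transport the rules of P^M.
    uncopied-model : ∀ {x} → x ∈ atoms P → M x ≡ true → J (sub nothing x) ≡ false →
      ∀ r → r ∈ P → SatRed M (M ∖ copied x) r
    uncopied-model {x} x∈A Mx Jt r r∈P applies with null (head r) in hr
    ... | true = ∖-satRed M (copied x) r (reduct-model⁻ P M M (proj₁ asP) r r∈P)
                   (λ _ a a∈h _ → ⊥-elim (null-empty (head r) hr a∈h)) applies
    ... | false with satJ _ (diag x r x∈A r∈P hr) diag-applies
      where
      diag-applies : Applies M⋆ (diagRule x r)
      diag-applies a a∈ with n , n∈ , refl ← diag-neg⁻ x r a∈ = applies n n∈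
    ... | inj₁ (a , a∈h , Ja) with diag-head⁻ x r a∈h
    ...   | inj₁ refl = clash Ja Jt
    ...   | inj₂ (p , p∈ , refl) = inj₂ (p , p∈ , ∖-removed M (copied x) p Ja)
    uncopied-model {x} x∈A Mx Jt r r∈P applies | false | inj₂ (a , a∈p , Ja) with diag-pos⁻ x r a∈p
    ... | h , h∈ , refl with M h in Mh
    ...   | true = inj₁ (h , h∈ , trans (∖-kept M (copied x) h Ja) Mh)
    ...   | false = clash (J-copy x∈A (atoms-head P r∈P h∈) Mx Mh) Ja

    -- Hence t_x ∈ J for all x ∈ M, by minimality of M (x_x ∈ J by the rule x_x ← not x̄).
    J-true : ∀ {x} → M x ≡ true → J (sub nothing x) ≡ true
    J-true {x} Mx with J (sub nothing x) in Jt
    ... | true = refl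
    ... | false = clash Mx (answerSet-disjoint P M (copied x) asP
                              (uncopied-model x∈A Mx Jt) x (J-self x∈A Mx))
      where x∈A = M⊆A x Mx

    M⋆⊆J : M⋆ ⊆ J
    M⋆⊆J (atm nothing) ()
    M⋆⊆J (atm (just x)) Mx = J-atom (M⊆A x Mx) Mx
    M⋆⊆J (bar x) e with M x in Mx
    ... | false = J-bar (∈ᵇ⁻ (∧-conicalˡ _ _ e)) Mx
    ... | true = clash e (∧-zeroʳ (x ∈ᵇ atoms P))
    M⋆⊆J (sub nothing x) Mx = J-true Mx
    M⋆⊆J (sub (just y) x) e =
      J-saturated (M⊆A x Mx) (∈ᵇ⁻ (∧-conicalʳ _ _ e)) (J-true Mx)
      where Mx = ∧-conicalˡ _ _ e

  answerSet⇒ : AnswerSet P M → AnswerSet (Pstar P) M⋆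
  answerSet⇒ asP = star-model⁺ P M⋆ M⋆ (M⋆-model (reduct-model⁻ P M M (proj₁ asP)))
                 , λ J mJ _ → Minimality.M⋆⊆J asP J mJ

module Backward (P : Program ℕ) (M : Interp ℕ) (M⊆A : ∀ x → M x ≡ true → x ∈ atoms P)
                (asS : AnswerSet (Pstar P) (M′ P M)) where

  open Forward P M M⊆A using (M⋆)

  satM⋆ : ∀ r → RuleOf P r → SatRed M⋆ M⋆ r
  satM⋆ = star-model⁻ P M⋆ M⋆ (proj₁ asS)

  M-model : ∀ r → r ∈ P → SatRed M M r
  M-model r r∈P applies with any M (head r) in Mh
  ... | true = inj₁ (any-true⁻ M (head r) Mh)
  ... | false with satM⋆ _ (mod r r∈P) mod-applies
    where
    mod-applies : Applies M⋆ ([] ⇐ map orig (pos r) ∣ map orig (head r ++ neg r))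
    mod-applies a a∈ with ∈-map⁻ _ a∈
    ... | b , b∈ , refl with ∈-++⁻ (head r) b∈
    ...   | inj₁ b∈h = any-false⁻ M (head r) Mh b b∈h
    ...   | inj₂ b∈n = applies b b∈n
  ... | inj₂ (a , a∈ , Ma) with ∈-map⁻ _ a∈
  ...   | p , p∈ , refl = inj₂ (p , p∈ , Ma)

  -- A model J ⊆ M of P^M missing some x ∈ M contradicts minimality of M⋆:
  -- removing t_x and the copies y_x of the atoms y ∈ J leaves a model of P*^{M⋆}.
  module Minimality (J : Interp ℕ) (J⊆M : J ⊆ M) (mJ : IsModel (reduct P M) J)
                    {x : ℕ} (Mx : M x ≡ true) (Jx : J x ≡ false) where

    dropped : TAtom → Bool
    dropped (sub nothing x′) = same x′ x
    dropped (sub (just y) x′) = same x′ x ∧ J y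
    dropped _ = false

    J⋆ : Interp TAtom
    J⋆ = M⋆ ∖ dropped

    J-off : ∀ {y} → M y ≡ false → J y ≡ false
    J-off {y} My with J y in Jy
    ... | true = clash (J⊆M y Jy) My
    ... | false = refl

    kept-copy : ∀ x′ y → (x′ ≡ x → J y ≡ false) → dropped (sub (just y) x′) ≡ false
    kept-copy x′ y h with same x′ x in e
    ... | true = h (same⇒≡ e)
    ... | false = refl

    -- J⋆ still satisfies every rule of P*^{M⋆}: most rules keep a true head atom, while
    -- the rules of P_x and y_x ← t_x lose a positive body atom instead.
    J⋆-model : ∀ r → RuleOf P r → SatRed M⋆ J⋆ r
    J⋆-model _ k@(xor-atom _ _) = ∖-satRed M⋆ dropped _ (satM⋆ _ k) λ { _ _ (here refl) _ → refl }
    J⋆-model _ k@(xor-bar _ _) = ∖-satRed M⋆ dropped _ (satM⋆ _ k) λ { _ _ (here refl) _ → refl }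
    J⋆-model _ k@(aux-self x′ _) = ∖-satRed M⋆ dropped _ (satM⋆ _ k)
      λ { _ _ (here refl) _ → kept-copy x′ x′ λ { refl → Jx } }
    J⋆-model _ k@(aux-copy x′ y _ _) = ∖-satRed M⋆ dropped _ (satM⋆ _ k)
      λ { applies _ (here refl) _ → kept-copy x′ y λ _ → J-off (applies _ (there (here refl))) }
    J⋆-model _ k@(mod _ _) = ∖-satRed M⋆ dropped _ (satM⋆ _ k) λ _ _ ()
    J⋆-model _ k@(true-copy _ _) = ∖-satRed M⋆ dropped _ (satM⋆ _ k) λ _ _ ()
    J⋆-model _ k@(saturate x′ y _ _) with x′ ≟ x
    ... | yes refl =
      λ _ → inj₂ (sub nothing x , here refl , ∖-removed M⋆ dropped (sub nothing x) (same-refl x))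
    ... | no x′≢x = ∖-satRed M⋆ dropped _ (satM⋆ _ k)
      λ { _ _ (here refl) _ → kept-copy x′ y λ e → ⊥-elim (x′≢x e) }
    J⋆-model _ k@(diag x′ r _ r∈P _) with x′ ≟ x
    ... | no x′≢x = ∖-satRed M⋆ dropped _ (satM⋆ _ k) λ _ a a∈h _ → spared a∈h
      where
      spared : ∀ {a} → a ∈ head (diagRule x′ r) → dropped a ≡ false
      spared a∈h with diag-head⁻ x′ r a∈h
      ... | inj₁ refl = same-≢ x′≢x
      ... | inj₂ (p , _ , refl) = kept-copy x′ p λ e → ⊥-elim (x′≢x e)
    ... | yes refl = λ applies → transport (reduct-model⁻ P M J mJ r r∈P
                                               λ n n∈ → applies (orig n) (diag-neg⁺ x r n∈))
      where
      -- for x′ = x the rule of P_x is the rule r of P^M read backwards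
      transport : SatPos J (head r) (pos r) → SatPos J⋆ (head (diagRule x r)) (pos (diagRule x r))
      transport (inj₁ (h , h∈ , Jh)) =
        inj₂ (sub (just h) x , diag-pos⁺ x r h∈ , ∖-removed M⋆ dropped (sub (just h) x) h-copied)
        where
        h-copied : dropped (sub (just h) x) ≡ true
        h-copied rewrite same-refl x = Jh
      transport (inj₂ (p , p∈ , Jp)) = inj₁ (sub (just p) x , diag-head⁺ x r p∈ ,
        trans (∖-kept M⋆ dropped (sub (just p) x) (kept-copy x p λ _ → Jp))
              (trans (M′-copy P M (atoms-pos P r∈P p∈)) Mx))

    absurd : ⊥
    absurd = clash Mx (answerSet-disjoint (Pstar P) M⋆ dropped asS
                         (λ r r∈ → J⋆-model r (classify P r r∈)) (sub nothing x) (same-refl x))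

  M-minimal : ∀ J → IsModel (reduct P M) J → J ⊆ M → M ⊆ J
  M-minimal J mJ J⊆M x Mx with J x in Jx
  ... | true = refl
  ... | false = ⊥-elim (Minimality.absurd J J⊆M mJ Mx Jx)

  answerSet⇐ : AnswerSet P M
  answerSet⇐ = reduct-model⁺ P M M M-model , M-minimal

-- The atoms of P* not built from at(P), including t itself; they occur in no head of P*.
outside : Program ℕ → TAtom → Bool
outside P (atm nothing) = true
outside P (atm (just x)) = not (x ∈ᵇ atoms P)
outside P (bar x) = not (x ∈ᵇ atoms P)
outside P (sub nothing x) = not (x ∈ᵇ atoms P)
outside P (sub (just y) x) = not ((x ∈ᵇ atoms P) ∧ (y ∈ᵇ atoms P))

module _ (P : Program ℕ) where

  inside-atom : ∀ {x} → x ∈ atoms P → outside P (orig x) ≡ false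
  inside-atom x∈A = cong not (∈ᵇ⁺ x∈A)

  inside-bar : ∀ {x} → x ∈ atoms P → outside P (bar x) ≡ false
  inside-bar x∈A = cong not (∈ᵇ⁺ x∈A)

  inside-copy : ∀ {x y} → x ∈ atoms P → y ∈ atoms P → outside P (sub (just y) x) ≡ false
  inside-copy x∈A y∈A = cong₂ (λ b c → not (b ∧ c)) (∈ᵇ⁺ x∈A) (∈ᵇ⁺ y∈A)

  M′-outside : (M : Interp ℕ) → (∀ x → M x ≡ true → x ∈ atoms P) →
    ∀ a → outside P a ≡ true → M′ P M a ≡ false
  M′-outside M M⊆A (atm nothing) o = refl
  M′-outside M M⊆A (atm (just x)) o = off-index o
    where
    off-index : ∀ {x} → not (x ∈ᵇ atoms P) ≡ true → M x ≡ false
    off-index {x} o with M x in Mx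
    ... | false = refl
    ... | true = clash (∈ᵇ⁺ (M⊆A x Mx)) (not-injective o)
  M′-outside M M⊆A (bar x) o rewrite not-injective {x ∈ᵇ atoms P} {false} o = refl
  M′-outside M M⊆A (sub nothing x) o = M′-outside M M⊆A (atm (just x)) o
  M′-outside M M⊆A (sub (just y) x) o with M x in Mx | x ∈ᵇ atoms P in xA
  ... | false | _ = refl
  ... | true | false = clash (∈ᵇ⁺ (M⊆A x Mx)) xA
  ... | true | true = not-injective o

module Shape (P : Program ℕ) (I : Interp TAtom) (asI : AnswerSet (Pstar P) I) where

  open ≡-Reasoning

  satI : ∀ r → RuleOf P r → SatRed I I r
  satI = star-model⁻ P I I (proj₁ asI)

  removable : (D : TAtom → Bool) → (∀ r → RuleOf P r → SatRed I (I ∖ D) r) → ∀ a → D a ≡ true → I a ≡ false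
  removable D sr = answerSet-disjoint (Pstar P) I D asI (λ r r∈ → sr r (classify P r r∈))

  spare : (D : TAtom → Bool) (r : Rule TAtom) → RuleOf P r →
    (Applies I r → ∀ a → a ∈ head r → I a ≡ true → D a ≡ false) → SatRed I (I ∖ D) r
  spare D r k = ∖-satRed I D r (satI r k)

  outside-false : ∀ a → outside P a ≡ true → I a ≡ false
  outside-false = removable (outside P) heads-inside
    where
    inside-diag : ∀ {x r a} → x ∈ atoms P → r ∈ P → a ∈ head (diagRule x r) → outside P a ≡ false
    inside-diag {x} {r} x∈A r∈P a∈h with diag-head⁻ x r a∈h
    ... | inj₁ refl = cong not (∈ᵇ⁺ x∈A)
    ... | inj₂ (p , p∈ , refl) = inside-copy P x∈A (atoms-pos P r∈P p∈)

    heads-inside : ∀ r → RuleOf P r → SatRed I (I ∖ outside P) r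
    heads-inside _ k@(xor-atom x x∈A) = spare _ _ k λ { _ _ (here refl) _ → inside-atom P x∈A }
    heads-inside _ k@(xor-bar x x∈A) = spare _ _ k λ { _ _ (here refl) _ → inside-bar P x∈A }
    heads-inside _ k@(aux-self x x∈A) = spare _ _ k λ { _ _ (here refl) _ → inside-copy P x∈A x∈A }
    heads-inside _ k@(aux-copy x y x∈A y∈A) = spare _ _ k λ { _ _ (here refl) _ → inside-copy P x∈A y∈A }
    heads-inside _ k@(diag x r x∈A r∈P _) = spare _ _ k λ _ a a∈h _ → inside-diag x∈A r∈P a∈h
    heads-inside _ k@(mod _ _) = spare _ _ k λ _ _ ()
    heads-inside _ k@(true-copy _ _) = spare _ _ k λ _ _ ()
    heads-inside _ k@(saturate x y x∈A y∈A) = spare _ _ k λ { _ _ (here refl) _ → inside-copy P x∈A y∈A }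

  bar-when-false : ∀ {x} → x ∈ atoms P → I (orig x) ≡ false → I (bar x) ≡ true
  bar-when-false {x} x∈A Ix with I (bar x) in Ib
  ... | true = refl
  ... | false = clash (forced I I (satI _ (xor-atom x x∈A)) λ { _ (here refl) → Ib }) Ix

  bar-when-true : ∀ {x} → x ∈ atoms P → I (orig x) ≡ true → I (bar x) ≡ false
  bar-when-true {x} x∈A Ix with I (bar x) in Ib
  ... | false = refl
  ... | true = clash Ix (removable this-atom spared (orig x) (same-refl x))
    where
    -- with x̄ ∈ I the only rule deriving x, x ← not x̄, is blocked, so x is removable
    this-atom : TAtom → Bool
    this-atom (atm (just y)) = same y x
    this-atom _ = false
    spared : ∀ r → RuleOf P r → SatRed I (I ∖ this-atom) r
    spared _ k@(xor-atom x′ _) = spare _ _ k λ { applies _ (here refl) _ → blocked x′ (applies _ (here refl)) }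
      where
      blocked : ∀ x′ → I (bar x′) ≡ false → same x′ x ≡ false
      blocked x′ Ib′ = same-≢ λ { refl → clash Ib Ib′ }
    spared _ k@(xor-bar _ _) = spare _ _ k λ { _ _ (here refl) _ → refl }
    spared _ k@(aux-self _ _) = spare _ _ k λ { _ _ (here refl) _ → refl }
    spared _ k@(aux-copy _ _ _ _) = spare _ _ k λ { _ _ (here refl) _ → refl }
    spared _ k@(diag x′ r _ _ _) = spare _ _ k λ _ a a∈h _ → not-atom (diag-head⁻ x′ r a∈h)
      where
      not-atom : ∀ {a} → a ≡ sub nothing x′ ⊎ (∃ λ p → p ∈ pos r × a ≡ sub (just p) x′) → this-atom a ≡ false
      not-atom (inj₁ refl) = refl
      not-atom (inj₂ (_ , _ , refl)) = refl
    spared _ k@(mod _ _) = spare _ _ k λ _ _ ()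
    spared _ k@(true-copy _ _) = spare _ _ k λ _ _ ()
    spared _ k@(saturate _ _ _ _) = spare _ _ k λ { _ _ (here refl) _ → refl }

  -- If x ∉ I, then no copy y_x (y ∈ at(P) ∪ {t}) is in I: its supporting rules are
  -- blocked by x̄, and the rules of P_x and y_x ← t_x lose their bodies together with it.
  copies-when-false : ∀ {x} → x ∈ atoms P → I (orig x) ≡ false → ∀ y → I (sub y x) ≡ false
  copies-when-false {x} x∈A Ix y = removable copies-at-x spared (sub y x) (same-refl x)
    where
    copies-at-x : TAtom → Bool
    copies-at-x (sub _ x′) = same x′ x
    copies-at-x _ = false

    blocked : ∀ x′ → I (bar x′) ≡ false → same x′ x ≡ false
    blocked x′ Ib′ = same-≢ λ { refl → clash (bar-when-false x∈A Ix) Ib′ }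

    removed : ∀ y → (I ∖ copies-at-x) (sub y x) ≡ false
    removed y = ∖-removed I copies-at-x (sub y x) (same-refl x)

    spared : ∀ r → RuleOf P r → SatRed I (I ∖ copies-at-x) r
    spared _ k@(xor-atom _ _) = spare _ _ k λ { _ _ (here refl) _ → refl }
    spared _ k@(xor-bar _ _) = spare _ _ k λ { _ _ (here refl) _ → refl }
    spared _ k@(aux-self x′ _) = spare _ _ k
      λ { applies _ (here refl) _ → blocked x′ (applies _ (here refl)) }
    spared _ k@(aux-copy x′ _ _ _) = spare _ _ k
      λ { applies _ (here refl) _ → blocked x′ (applies _ (here refl)) }
    spared _ k@(mod _ _) = spare _ _ k λ _ _ ()
    spared _ k@(true-copy _ _) = spare _ _ k λ _ _ ()
    spared _ k@(diag x′ r _ _ hr) with x′ ≟ x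
    ... | no x′≢x = spare _ _ k λ _ a a∈h _ → elsewhere (diag-head⁻ x′ r a∈h)
      where
      elsewhere : ∀ {a} → a ≡ sub nothing x′ ⊎ (∃ λ p → p ∈ pos r × a ≡ sub (just p) x′) →
        copies-at-x a ≡ false
      elsewhere (inj₁ refl) = same-≢ x′≢x
      elsewhere (inj₂ (_ , _ , refl)) = same-≢ x′≢x
    ... | yes refl with null-nonempty (head r) hr
    ...   | h , h∈ = λ _ → inj₂ (sub (just h) x , diag-pos⁺ x r h∈ , removed (just h))
    spared _ k@(saturate x′ _ _ _) with x′ ≟ x
    ... | no x′≢x = spare _ _ k λ { _ _ (here refl) _ → same-≢ x′≢x }
    ... | yes refl = λ _ → inj₂ (sub nothing x , here refl , removed nothing)

  -- If x ∈ I, then t_x ∈ I (by ⊥ ← x, not t_x) and hence y_x ∈ I (by y_x ← t_x).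
  true-when-true : ∀ {x} → x ∈ atoms P → I (orig x) ≡ true → I (sub nothing x) ≡ true
  true-when-true {x} x∈A Ix with I (sub nothing x) in It
  ... | true = refl
  ... | false = clash Ix (excluded I I (satI _ (true-copy x x∈A)) λ { _ (here refl) → It })

  copy-when-true : ∀ {x y} → x ∈ atoms P → y ∈ atoms P → I (orig x) ≡ true → I (sub (just y) x) ≡ true
  copy-when-true {x} {y} x∈A y∈A Ix =
    forced-by I I (satI _ (saturate x y x∈A y∈A)) (true-when-true x∈A Ix)

  I-bar : ∀ {x} → x ∈ atoms P → I (bar x) ≡ not (I (orig x))
  I-bar {x} x∈A with I (orig x) in Ix
  ... | true = bar-when-true x∈A Ix
  ... | false = bar-when-false x∈A Ix

  I-true : ∀ {x} → x ∈ atoms P → I (sub nothing x) ≡ I (orig x)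
  I-true {x} x∈A with I (orig x) in Ix
  ... | true = true-when-true x∈A Ix
  ... | false = copies-when-false x∈A Ix nothing

  I-copy : ∀ {x y} → x ∈ atoms P → y ∈ atoms P → I (sub (just y) x) ≡ I (orig x)
  I-copy {x} x∈A y∈A with I (orig x) in Ix
  ... | true = copy-when-true x∈A y∈A Ix
  ... | false = copies-when-false x∈A Ix _

  M : Interp ℕ
  M x = (x ∈ᵇ atoms P) ∧ I (orig x)

  M⊆A : ∀ x → M x ≡ true → x ∈ atoms P
  M⊆A x e = ∈ᵇ⁻ (∧-conicalˡ _ _ e)

  M-inside : ∀ {x} → x ∈ atoms P → M x ≡ I (orig x)
  M-inside x∈A rewrite ∈ᵇ⁺ x∈A = refl

  agree-outside : ∀ a → outside P a ≡ true → I a ≡ M′ P M a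
  agree-outside a o = trans (outside-false a o) (sym (M′-outside P M M⊆A a o))

  I≡M′ : ∀ a → I a ≡ M′ P M a
  I≡M′ (atm nothing) = agree-outside _ refl
  I≡M′ (atm (just x)) with x ∈? atoms P
  ... | no x∉A = agree-outside _ (cong not (∉ᵇ x∉A))
  ... | yes x∈A = sym (M-inside x∈A)
  I≡M′ (bar x) with x ∈? atoms P
  ... | no x∉A = agree-outside _ (cong not (∉ᵇ x∉A))
  ... | yes x∈A = begin
    I (bar x)          ≡⟨ I-bar x∈A ⟩
    not (I (orig x))   ≡⟨ cong not (M-inside x∈A) ⟨
    not (M x)          ≡⟨ M′-bar P M x∈A ⟨
    M′ P M (bar x)     ∎
  I≡M′ (sub nothing x) with x ∈? atoms P
  ... | no x∉A = agree-outside _ (cong not (∉ᵇ x∉A))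
  ... | yes x∈A = trans (I-true x∈A) (sym (M-inside x∈A))
  I≡M′ (sub (just y) x) with x ∈? atoms P | y ∈? atoms P
  ... | no x∉A | _ = agree-outside _ (cong (λ b → not (b ∧ (y ∈ᵇ atoms P))) (∉ᵇ x∉A))
  ... | yes x∈A | no y∉A = agree-outside _ (cong₂ (λ b c → not (b ∧ c)) (∈ᵇ⁺ x∈A) (∉ᵇ y∉A))
  ... | yes x∈A | yes y∈A = begin
    I (sub (just y) x)       ≡⟨ I-copy x∈A y∈A ⟩
    I (orig x)               ≡⟨ M-inside x∈A ⟨
    M x                      ≡⟨ M′-copy P M y∈A ⟨
    M′ P M (sub (just y) x)  ∎

theorem4 : (P : Program ℕ) →
    ((M : Interp ℕ) → (∀ x → M x ≡ true → x ∈ atoms P) →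
      (AnswerSet P M ⇔ AnswerSet (Pstar P) (M′ P M)))
    × ((I : Interp TAtom) → AnswerSet (Pstar P) I →
      Σ (Interp ℕ) (λ M → (∀ x → M x ≡ true → x ∈ atoms P) × (∀ a → I a ≡ M′ P M a)))
theorem4 P = correspondence , completeness
  where
  correspondence : (M : Interp ℕ) → (∀ x → M x ≡ true → x ∈ atoms P) →
    AnswerSet P M ⇔ AnswerSet (Pstar P) (M′ P M)
  correspondence M M⊆A = mk⇔ (Forward.answerSet⇒ P M M⊆A) (Backward.answerSet⇐ P M M⊆A)

  completeness : (I : Interp TAtom) → AnswerSet (Pstar P) I →
    Σ (Interp ℕ) (λ M → (∀ x → M x ≡ true → x ∈ atoms P) × (∀ a → I a ≡ M′ P M a))
  completeness I asI = M , M⊆A , I≡M′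
    where open Shape P I asI
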